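{- The height of an optimal basic tree representing a displacement sequence of length $n$ is $O(\log n)$.
   Context: A displacement sequence is a finite sequence of integers. A basic tree is a rooted ordered tree whose nodes are of four kinds: a leaf $\mathsf{con}(c)$; $\mathsf{vec}(c,d,C)$ (count $c$, stride $d$, one child $C$); $\mathsf{idx}(c,\langle i_0,\dots,i_{c-1}\rangle,C)$ (one child); $\mathsf{strc}(c,\langle i_0,\dots,i_{c-1}\rangle,\langle C_0,\dots,C_{c-1}\rangle)$ ($c$ children). With $S+x$ denoting $S$ with $x$ added to each entry, the represented sequence is defined recursively: $\mathrm{Flat}(\mathsf{con}(c))=\langle 0,\dots,c-1\rangle$; $\mathrm{Flat}(\mathsf{vec}(c,d,C))=$ concatenation of $\mathrm{Flat}(C)+kd$, $k=0,\dots,c-1$; $\mathrm{Flat}(\mathsf{idx}(c,\langle i_k\rangle,C))=$ concatenation of $\mathrm{Flat}(C)+i_k$; $\mathrm{Flat}(\mathsf{strc}(c,\langle i_k\rangle,\langle C_k\rangle))=$ concatenation of $\mathrm{Flat}(C_k)+i_k$. $T$ represents $D$ if $\mathrm{Flat}(T)=D$. Costs (fixed positive constants $K$): $\mathrm{cost}(\mathsf{con})=K_{\mathsf{con}}$, $\mathrm{cost}(\mathsf{vec})=K_{\mathsf{vec}}$, $\mathrm{cost}(\mathsf{idx}(c,\dots))=K_{\mathsf{idx}}+cK_{\mathrm{lookup}}$, $\mathrm{cost}(\mathsf{strc}(c,\dots))=K_{\mathsf{strc}}+2cK_{\mathrm{lookup}}$; tree cost is the sum of node costs. A basic tree is optimal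 for $D$ if it represents $D$ and has minimum cost among all basic trees representing $D$. Height is the maximum number of nodes (equivalently edges) on a root-to-leaf path.
   Formalization: The fixed cost constants $K$ are taken to be positive rationals. -}

module Defs where

open import Data.Nat as ℕ using (ℕ; zero; suc; _⊔_)
open import Data.Integer as ℤ using (ℤ; +_)
open import Data.Rational as ℚ using (ℚ; 0ℚ; _/_)
open import Data.List using (List; []; _∷_; _++_; map; upTo; length; concat)
open import Data.Vec using (Vec; []; _∷_)
open import Relation.Binary.PropositionalEquality using (_≡_)

DispSeq : Set
DispSeq = List ℤ

data Tree : Set where
  con  : (c : ℕ) → Tree
  vec  : (c : ℕ) (d : ℤ) (C : Tree) → Tree
  idx  : (c : ℕ) (is : Vec ℤ c) (C : Tree) → Tree
  strc : (c : ℕ) (is : Vec ℤ c) (Cs : Vec Tree c) → Tree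

shift : List ℤ → ℤ → List ℤ
shift S x = map (ℤ._+ x) S

concatShifts : ∀ {c} → List ℤ → Vec ℤ c → List ℤ
concatShifts S []       = []
concatShifts S (i ∷ is) = shift S i ++ concatShifts S is

mutual
  Flat : Tree → List ℤ
  Flat (con c)         = map +_ (upTo c)
  Flat (vec c d C)     = concat (map (λ k → shift (Flat C) (+ k ℤ.* d)) (upTo c))
  Flat (idx c is C)    = concatShifts (Flat C) is
  Flat (strc c is Cs)  = FlatStrc is Cs

  FlatStrc : ∀ {c} → Vec ℤ c → Vec Tree c → List ℤ
  FlatStrc []       []       = []
  FlatStrc (i ∷ is) (C ∷ Cs) = shift (Flat C) i ++ FlatStrc is Cs

Represents : Tree → DispSeq → Set
Represents T D = Flat T ≡ D

record CostConstants : Set where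
  field
    Kcon Kvec Kidx Kstrc Klookup : ℚ
    Kcon>0    : 0ℚ ℚ.< Kcon
    Kvec>0    : 0ℚ ℚ.< Kvec
    Kidx>0    : 0ℚ ℚ.< Kidx
    Kstrc>0   : 0ℚ ℚ.< Kstrc
    Klookup>0 : 0ℚ ℚ.< Klookup

ℕtoℚ : ℕ → ℚ
ℕtoℚ n = (+ n) / 1

module _ (K : CostConstants) where
  open CostConstants K

  mutual
    cost : Tree → ℚ
    cost (con c)        = Kcon
    cost (vec c d C)    = Kvec ℚ.+ cost C
    cost (idx c is C)   = (Kidx ℚ.+ ℕtoℚ c ℚ.* Klookup) ℚ.+ cost C
    cost (strc c is Cs) = (Kstrc ℚ.+ ℕtoℚ (2 ℕ.* c) ℚ.* Klookup) ℚ.+ costs Cs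

    costs : ∀ {c} → Vec Tree c → ℚ
    costs []       = 0ℚ
    costs (C ∷ Cs) = cost C ℚ.+ costs Cs

  Optimal : Tree → DispSeq → Set
  Optimal T D = Represents T D × (∀ T′ → Represents T′ D → cost T ℚ.≤ cost T′)
    where open import Data.Product using (_×_)

mutual
  height : Tree → ℕ
  height (con c)        = 1
  height (vec c d C)    = suc (height C)
  height (idx c is C)   = suc (height C)
  height (strc c is Cs) = suc (heights Cs)

  heights : ∀ {c} → Vec Tree c → ℕ
  heights []       = 0
  heights (C ∷ Cs) = height C ⊔ heights Cs

-- A vec or idx node with count c ≥ 2 represents c shifted copies of
-- its child's sequence, so the child's sequence is at most half as long
-- (count 1 vec nodes are never optimal, and count 0 nodes represent the
-- empty sequence, below which only a cheapest tree of height 1 can sit).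
-- The nodes that do not shrink the sequence are the offset nodes: idx with
-- a single offset, and strc.  An offset node never sits directly below
-- another offset node in an optimal tree, because the lower one could be
-- absorbed into the upper one at strictly smaller cost.  Hence the length at
-- least halves every two steps along any root-to-leaf path.
module Submission where

open import Defs
open import Data.Nat using (ℕ; _≤_; _+_; _*_; zero; suc; z≤n; s≤s)
import Data.Nat.Properties as ℕP
open import Data.Nat.Logarithm using (⌊log₂_⌋; ⌊log₂⌋-mono-≤; ⌊log₂[2*b]⌋≡1+⌊log₂b⌋)
open import Data.Nat.Tactic.RingSolver using (solve-∀)
open import Data.Nat.Coprimality using (1-coprimeTo) renaming (sym to coprime-sym)
open import Data.Integer as ℤ using (ℤ; +_)
import Data.Integer.Properties as ℤP
open import Data.Rational as ℚ using (ℚ; mkℚ; 0ℚ)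
import Data.Rational.Properties as ℚP
open import Data.Rational.Solver using (module +-*-Solver)
open import Data.List using (List; []; _∷_; _++_; [_]; length; concatMap; upTo)
import Data.List.Properties as ListP
open import Data.List.Membership.Propositional using (_∈_)
open import Data.List.Membership.Propositional.Properties using (∈-∃++)
open import Data.List.Relation.Unary.Any using (here; there)
open import Data.Vec as Vec using (Vec; []; _∷_)
open import Data.Product using (Σ; _×_; _,_; proj₁)
open import Data.Empty using (⊥; ⊥-elim)
open import Function using (_∘_)
open import Relation.Binary.PropositionalEquality hiding ([_])

logBound : ℕ → ℕ → ℕ
logBound n s = 2 * ⌊log₂ n ⌋ + s

logBound-monoˡ : ∀ {m n} s → m ≤ n → logBound m s ≤ logBound n s
logBound-monoˡ s m≤n = ℕP.+-monoˡ-≤ s (ℕP.*-monoʳ-≤ 2 (⌊log₂⌋-mono-≤ m≤n))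

logBound-monoʳ : ∀ n {s t} → s ≤ t → logBound n s ≤ logBound n t
logBound-monoʳ n = ℕP.+-monoʳ-≤ (2 * ⌊log₂ n ⌋)

log-copies : ∀ c L → 1 ≤ L → suc ⌊log₂ L ⌋ ≤ ⌊log₂ (suc (suc c) * L) ⌋
log-copies c (suc L) _ = begin
  suc ⌊log₂ suc L ⌋           ≡⟨ ⌊log₂[2*b]⌋≡1+⌊log₂b⌋ (suc L) ⟨
  ⌊log₂ 2 * suc L ⌋           ≤⟨ ⌊log₂⌋-mono-≤ (ℕP.*-monoˡ-≤ (suc L) {2} {suc (suc c)} 2≤2+c) ⟩
  ⌊log₂ suc (suc c) * suc L ⌋ ∎
  where
  open ℕP.≤-Reasoning
  2≤2+c : 2 ≤ suc (suc c)
  2≤2+c = s≤s (s≤s z≤n)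

halving : ∀ c L {h s} → 1 ≤ L → s ≤ 3 → h ≤ logBound L s →
          suc h ≤ logBound (suc (suc c) * L) 2
halving c L {h} {s} L≥1 s≤3 h≤ = begin
  suc h                               ≤⟨ s≤s (ℕP.≤-trans h≤ (logBound-monoʳ L s≤3)) ⟩
  suc (2 * ⌊log₂ L ⌋ + 3)             ≡⟨ regroup ⌊log₂ L ⌋ ⟨
  2 * suc ⌊log₂ L ⌋ + 2               ≤⟨ ℕP.+-monoˡ-≤ 2 (ℕP.*-monoʳ-≤ 2 (log-copies c L L≥1)) ⟩
  logBound (suc (suc c) * L) 2        ∎
  where
  open ℕP.≤-Reasoning
  regroup : ∀ x → 2 * suc x + 2 ≡ suc (2 * x + 3)
  regroup = solve-∀

within-two : ∀ n {h} → h ≤ 2 → h ≤ logBound n 2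
within-two n h≤2 = ℕP.≤-trans h≤2 (ℕP.m≤n+m 2 (2 * ⌊log₂ n ⌋))

offset-step : ∀ n {h} → h ≤ logBound n 2 → suc h ≤ logBound n 3
offset-step n h≤ = ℕP.≤-trans (s≤s h≤) (ℕP.≤-reflexive (sym (ℕP.+-suc (2 * ⌊log₂ n ⌋) 2)))

ℕtoℚ-normal : ∀ n → ℕtoℚ n ≡ mkℚ (+ n) 0 (coprime-sym (1-coprimeTo n))
ℕtoℚ-normal n = ℚP.↥p/↧p≡p (mkℚ (+ n) 0 (coprime-sym (1-coprimeTo n)))

ℕtoℚ-+ : ∀ m n → ℕtoℚ (m + n) ≡ ℕtoℚ m ℚ.+ ℕtoℚ n
ℕtoℚ-+ m n rewrite ℕtoℚ-normal m | ℕtoℚ-normal n =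
  cong (ℚ._/ 1) (sym (cong₂ ℤ._+_ (ℤP.*-identityʳ (+ m)) (ℤP.*-identityʳ (+ n))))

<-+ˡ : ∀ {a} x → 0ℚ ℚ.< a → x ℚ.< a ℚ.+ x
<-+ˡ {a} x 0<a = subst (ℚ._< a ℚ.+ x) (ℚP.+-identityˡ x) (ℚP.+-monoˡ-< x 0<a)

≤-+ˡ : ∀ {a} x → 0ℚ ℚ.≤ a → x ℚ.≤ a ℚ.+ x
≤-+ˡ {a} x 0≤a = subst (ℚ._≤ a ℚ.+ x) (ℚP.+-identityˡ x) (ℚP.+-monoˡ-≤ x 0≤a)

≤-+ʳ : ∀ {b} x → 0ℚ ℚ.≤ b → x ℚ.≤ x ℚ.+ b
≤-+ʳ {b} x 0≤b = subst (ℚ._≤ x ℚ.+ b) (ℚP.+-identityʳ x) (ℚP.+-monoʳ-≤ x 0≤b)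

length-zero : ∀ {A : Set} {xs : List A} → length xs ≡ 0 → xs ≡ []
length-zero {xs = []} _ = refl

shift-shift : ∀ S j i → shift (shift S j) i ≡ shift S (j ℤ.+ i)
shift-shift S j i = trans (sym (ListP.map-∘ S)) (ListP.map-cong (λ x → ℤP.+-assoc x j i) S)

shift-zero : ∀ S → shift S (+ 0) ≡ S
shift-zero S = trans (ListP.map-cong ℤP.+-identityʳ S) (ListP.map-id S)

length-vec : ∀ c d C → length (Flat (vec c d C)) ≡ c * length (Flat C)
length-vec c d C = trans (copies (upTo c)) (cong (_* length (Flat C)) (ListP.length-upTo c))
  where
  copies : ∀ ks → length (concatMap (λ k → shift (Flat C) (+ k ℤ.* d)) ks) ≡ length ks * length (Flat C)
  copies []       = refl
  copies (k ∷ ks) = trans (ListP.length-++ (shift (Flat C) (+ k ℤ.* d)))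
                          (cong₂ _+_ (ListP.length-map _ (Flat C)) (copies ks))

length-idx : ∀ {c} (is : Vec ℤ c) C → length (Flat (idx c is C)) ≡ c * length (Flat C)
length-idx []       C = refl
length-idx (i ∷ is) C = trans (ListP.length-++ (shift (Flat C) i))
                              (cong₂ _+_ (ListP.length-map _ (Flat C)) (length-idx is C))

Flat-vec₁ : ∀ d C → Flat (vec 1 d C) ≡ Flat C
Flat-vec₁ d C = begin
  shift (Flat C) (+ 0 ℤ.* d) ++ [] ≡⟨ ListP.++-identityʳ _ ⟩
  shift (Flat C) (+ 0 ℤ.* d)       ≡⟨ cong (shift (Flat C)) (ℤP.*-zeroˡ d) ⟩
  shift (Flat C) (+ 0)             ≡⟨ shift-zero (Flat C) ⟩
  Flat C                           ∎
  where open ≡-Reasoning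

length-idx₁ : ∀ i C → length (Flat (idx 1 (i ∷ []) C)) ≡ length (Flat C)
length-idx₁ i C = trans (length-idx (i ∷ []) C) (ℕP.*-identityˡ (length (Flat C)))

Flat-absorb-idx₁ : ∀ i j C →
  Flat (idx 1 (j ℤ.+ i ∷ []) C) ≡ Flat (idx 1 (i ∷ []) (idx 1 (j ∷ []) C))
Flat-absorb-idx₁ i j C = cong (_++ []) (begin
  shift (Flat C) (j ℤ.+ i)         ≡⟨ shift-shift (Flat C) j i ⟨
  shift (shift (Flat C) j) i       ≡⟨ cong (λ S → shift S i) (ListP.++-identityʳ _) ⟨
  shift (shift (Flat C) j ++ []) i ∎)
  where open ≡-Reasoning

Flat-absorb-strc : ∀ i {c} (js : Vec ℤ c) Ds →
  Flat (strc c (Vec.map (ℤ._+ i) js) Ds) ≡ Flat (idx 1 (i ∷ []) (strc c js Ds))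
Flat-absorb-strc i js Ds = trans (shifted js Ds) (sym (ListP.++-identityʳ _))
  where
  shifted : ∀ {c} (js : Vec ℤ c) Ds → FlatStrc (Vec.map (ℤ._+ i) js) Ds ≡ shift (FlatStrc js Ds) i
  shifted []       []       = refl
  shifted (j ∷ js) (D ∷ Ds) = begin
    shift (Flat D) (j ℤ.+ i) ++ FlatStrc (Vec.map (ℤ._+ i) js) Ds
      ≡⟨ cong₂ _++_ (sym (shift-shift (Flat D) j i)) (shifted js Ds) ⟩
    shift (shift (Flat D) j) i ++ shift (FlatStrc js Ds) i
      ≡⟨ ListP.map-++ (ℤ._+ i) (shift (Flat D) j) (FlatStrc js Ds) ⟨
    shift (shift (Flat D) j ++ FlatStrc js Ds) i ∎
    where open ≡-Reasoning

-- The children of a strc node, viewed as a list of (offset, subtree) pairs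
-- so that segments of children can be cut out and replaced.
Child : Set
Child = ℤ × Tree

children : ∀ {c} → Vec ℤ c → Vec Tree c → List Child
children []       []       = []
children (i ∷ is) (C ∷ Cs) = (i , C) ∷ children is Cs

flatChild : Child → List ℤ
flatChild (i , C) = shift (Flat C) i

flatChildren : List Child → List ℤ
flatChildren = concatMap flatChild

flatChildren-children : ∀ {c} (is : Vec ℤ c) Cs → flatChildren (children is Cs) ≡ Flat (strc c is Cs)
flatChildren-children []       []       = refl
flatChildren-children (i ∷ is) (C ∷ Cs) = cong (_ ++_) (flatChildren-children is Cs)

flatChildren-splice : ∀ l₁ {m m′} l₂ → flatChildren m ≡ flatChildren m′ →
  flatChildren (l₁ ++ m ++ l₂) ≡ flatChildren (l₁ ++ m′ ++ l₂)
flatChildren-splice l₁ {m} {m′} l₂ eq = begin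
  flatChildren (l₁ ++ m ++ l₂)                          ≡⟨ split-off m ⟩
  flatChildren l₁ ++ flatChildren m ++ flatChildren l₂  ≡⟨ cong (λ S → flatChildren l₁ ++ S ++ flatChildren l₂) eq ⟩
  flatChildren l₁ ++ flatChildren m′ ++ flatChildren l₂ ≡⟨ split-off m′ ⟨
  flatChildren (l₁ ++ m′ ++ l₂)                         ∎
  where
  open ≡-Reasoning
  split-off : ∀ m → flatChildren (l₁ ++ m ++ l₂) ≡ flatChildren l₁ ++ flatChildren m ++ flatChildren l₂
  split-off m = trans (ListP.concatMap-++ flatChild l₁ (m ++ l₂))
                      (cong (flatChildren l₁ ++_) (ListP.concatMap-++ flatChild m l₂))

length-flatChild : ∀ {x l} → x ∈ l → length (flatChild x) ≤ length (flatChildren l)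
length-flatChild {x} {l = _ ∷ l} (here refl) =
  ListP.length-++-≤ˡ (flatChild x) {flatChildren l}
length-flatChild {l = y ∷ l} (there x∈l) =
  ℕP.≤-trans (length-flatChild x∈l) (ListP.length-++-≤ʳ (flatChildren l) {flatChild y})

offsets : (l : List Child) → Vec ℤ (length l)
offsets []            = []
offsets ((i , _) ∷ l) = i ∷ offsets l

subtrees : (l : List Child) → Vec Tree (length l)
subtrees []            = []
subtrees ((_ , C) ∷ l) = C ∷ subtrees l

strcOf : List Child → Tree
strcOf l = strc (length l) (offsets l) (subtrees l)

children-strcOf : ∀ l → children (offsets l) (subtrees l) ≡ l
children-strcOf []      = refl
children-strcOf (x ∷ l) = cong (x ∷_) (children-strcOf l)

Flat-strcOf : ∀ l → Flat (strcOf l) ≡ flatChildren l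
Flat-strcOf l = trans (sym (flatChildren-children (offsets l) (subtrees l)))
                      (cong flatChildren (children-strcOf l))

strc-child-length : ∀ {c} {is : Vec ℤ c} {Cs i C} → (i , C) ∈ children is Cs →
  length (Flat C) ≤ length (Flat (strc c is Cs))
strc-child-length {is = is} {Cs} {i} {C} mem =
  subst₂ _≤_ (ListP.length-map (ℤ._+ i) (Flat C)) (cong length (flatChildren-children is Cs))
         (length-flatChild mem)

-- Offset nodes (idx with one offset, and strc) do not shrink the
-- represented sequence; they get one more unit of slack in the bound.
slack : Tree → ℕ
slack (idx 1 _ _)  = 3
slack (strc _ _ _) = 3
slack _            = 2

at-slack-two : ∀ n C {h} → slack C ≡ 2 → h ≤ logBound n (slack C) → h ≤ logBound n 2
at-slack-two n C {h} slack≡2 = subst (λ s → h ≤ logBound n s) slack≡2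

slack≤3 : ∀ T → slack T ≤ 3
slack≤3 (con _)                 = ℕP.n≤1+n 2
slack≤3 (vec _ _ _)             = ℕP.n≤1+n 2
slack≤3 (idx zero _ _)          = ℕP.n≤1+n 2
slack≤3 (idx (suc zero) _ _)    = ℕP.≤-refl
slack≤3 (idx (suc (suc _)) _ _) = ℕP.n≤1+n 2
slack≤3 (strc _ _ _)            = ℕP.≤-refl

module Optimality (K : CostConstants) where
  open CostConstants K

  OptimalTree : Tree → Set
  OptimalTree T = ∀ T′ → Represents T′ (Flat T) → cost K T ℚ.≤ cost K T′

  optimal⇒OptimalTree : ∀ {T D} → Optimal K T D → OptimalTree T
  optimal⇒OptimalTree (represents , minimal) T′ eq = minimal T′ (trans eq represents)

  not-optimal : ∀ T T′ → OptimalTree T → Represents T′ (Flat T) → cost K T′ ℚ.< cost K T → ⊥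
  not-optimal T T′ opt eq cheaper = ℚP.<-irrefl refl (ℚP.<-≤-trans cheaper (opt T′ eq))

  0≤table : ∀ c → 0ℚ ℚ.≤ ℕtoℚ c ℚ.* Klookup
  0≤table c = ℚP.nonNegative⁻¹ _
    {{ℚP.nonNeg*nonNeg⇒nonNeg (ℕtoℚ c) {{ℚP.normalize-nonNeg c 1}}
                              Klookup {{ℚ.nonNegative (ℚP.<⇒≤ Klookup>0)}}}}

  0<idx : ∀ c → 0ℚ ℚ.< Kidx ℚ.+ ℕtoℚ c ℚ.* Klookup
  0<idx c = ℚP.<-≤-trans Kidx>0 (≤-+ʳ Kidx (0≤table c))

  mutual
    cost-positive : ∀ T → 0ℚ ℚ.< cost K T
    cost-positive (con c)        = Kcon>0
    cost-positive (vec c d C)    = ℚP.<-≤-trans Kvec>0 (≤-+ʳ Kvec (ℚP.<⇒≤ (cost-positive C)))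
    cost-positive (idx c is C)   = ℚP.<-≤-trans (0<idx c) (≤-+ʳ _ (ℚP.<⇒≤ (cost-positive C)))
    cost-positive (strc c is Cs) =
      ℚP.<-≤-trans (ℚP.<-≤-trans Kstrc>0 (≤-+ʳ Kstrc (0≤table (2 * c)))) (≤-+ʳ _ (costs-nonneg Cs))

    costs-nonneg : ∀ {c} (Cs : Vec Tree c) → 0ℚ ℚ.≤ costs K Cs
    costs-nonneg []       = ℚP.≤-refl
    costs-nonneg (C ∷ Cs) = ℚP.≤-trans (costs-nonneg Cs) (≤-+ˡ _ (ℚP.<⇒≤ (cost-positive C)))

  childCost : Child → ℚ
  childCost (_ , C) = ℕtoℚ 2 ℚ.* Klookup ℚ.+ cost K C

  childrenCost : List Child → ℚ
  childrenCost []      = 0ℚ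
  childrenCost (x ∷ l) = childCost x ℚ.+ childrenCost l

  childrenCost-++ : ∀ l m → childrenCost (l ++ m) ≡ childrenCost l ℚ.+ childrenCost m
  childrenCost-++ []      m = sym (ℚP.+-identityˡ (childrenCost m))
  childrenCost-++ (x ∷ l) m = trans (cong (childCost x ℚ.+_) (childrenCost-++ l m))
                                    (sym (ℚP.+-assoc (childCost x) (childrenCost l) (childrenCost m)))

  childrenCost-nonneg : ∀ l → 0ℚ ℚ.≤ childrenCost l
  childrenCost-nonneg []            = ℚP.≤-refl
  childrenCost-nonneg ((_ , C) ∷ l) = ℚP.≤-trans (childrenCost-nonneg l)
    (≤-+ˡ _ (ℚP.≤-trans (ℚP.<⇒≤ (cost-positive C)) (≤-+ˡ _ (0≤table 2))))

  childrenCost-offsets : ∀ {c} (is js : Vec ℤ c) Cs →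
    childrenCost (children is Cs) ≡ childrenCost (children js Cs)
  childrenCost-offsets []       []       []       = refl
  childrenCost-offsets (_ ∷ is) (_ ∷ js) (C ∷ Cs) =
    cong (ℕtoℚ 2 ℚ.* Klookup ℚ.+ cost K C ℚ.+_) (childrenCost-offsets is js Cs)

  tables-children : ∀ {c} (is : Vec ℤ c) Cs →
    ℕtoℚ (2 * c) ℚ.* Klookup ℚ.+ costs K Cs ≡ childrenCost (children is Cs)
  tables-children []       []       = trans (ℚP.+-identityʳ _) (ℚP.*-zeroˡ Klookup)
  tables-children {suc c} (i ∷ is) (C ∷ Cs) = begin
    ℕtoℚ (2 * suc c) ℚ.* Klookup ℚ.+ (cost K C ℚ.+ costs K Cs)
      ≡⟨ cong (λ q → q ℚ.* Klookup ℚ.+ (cost K C ℚ.+ costs K Cs))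
              (trans (cong ℕtoℚ (ℕP.*-suc 2 c)) (ℕtoℚ-+ 2 (2 * c))) ⟩
    (ℕtoℚ 2 ℚ.+ ℕtoℚ (2 * c)) ℚ.* Klookup ℚ.+ (cost K C ℚ.+ costs K Cs)
      ≡⟨ solve 5 (λ t u k x y → (t :+ u) :* k :+ (x :+ y) := (t :* k :+ x) :+ (u :* k :+ y))
               refl (ℕtoℚ 2) (ℕtoℚ (2 * c)) Klookup (cost K C) (costs K Cs) ⟩
    childCost (i , C) ℚ.+ (ℕtoℚ (2 * c) ℚ.* Klookup ℚ.+ costs K Cs)
      ≡⟨ cong (childCost (i , C) ℚ.+_) (tables-children is Cs) ⟩
    childCost (i , C) ℚ.+ childrenCost (children is Cs) ∎
    where
    open ≡-Reasoning
    open +-*-Solver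

  cost-strc : ∀ {c} (is : Vec ℤ c) Cs → cost K (strc c is Cs) ≡ Kstrc ℚ.+ childrenCost (children is Cs)
  cost-strc is Cs = trans (ℚP.+-assoc Kstrc _ (costs K Cs)) (cong (Kstrc ℚ.+_) (tables-children is Cs))

  cost-strcOf : ∀ l → cost K (strcOf l) ≡ Kstrc ℚ.+ childrenCost l
  cost-strcOf l = trans (cost-strc (offsets l) (subtrees l))
                        (cong (λ m → Kstrc ℚ.+ childrenCost m) (children-strcOf l))

  hole-cheapest : ∀ (F : Tree → Tree) k {C C′} → (∀ X → cost K (F X) ≡ k ℚ.+ cost K X) →
    OptimalTree (F C) → Flat (F C′) ≡ Flat (F C) → cost K C ℚ.≤ cost K C′
  hole-cheapest F k {C} {C′} cost-F opt eq = ℚP.≮⇒≥ λ cheaper →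
    not-optimal (F C) (F C′) opt eq
      (subst₂ ℚ._<_ (sym (cost-F C′)) (sym (cost-F C)) (ℚP.+-monoʳ-< k cheaper))

  vec-child-optimal : ∀ c d C → OptimalTree (vec c d C) → OptimalTree C
  vec-child-optimal c d C opt C′ eq =
    hole-cheapest (vec c d) Kvec {C} {C′} (λ _ → refl) opt
      (cong (λ S → concatMap (λ k → shift S (+ k ℤ.* d)) (upTo c)) eq)

  idx-child-optimal : ∀ c is C → OptimalTree (idx c is C) → OptimalTree C
  idx-child-optimal c is C opt C′ eq =
    hole-cheapest (idx c is) (Kidx ℚ.+ ℕtoℚ c ℚ.* Klookup) {C} {C′} (λ _ → refl) opt
      (cong (λ S → concatShifts S is) eq)

  Cheapest : Tree → Set
  Cheapest C = ∀ C′ → cost K C ℚ.≤ cost K C′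

  -- Every node is dearer than its first child, so a cheapest tree is a leaf.
  cheapest-height : ∀ C → Cheapest C → height C ≤ 1
  cheapest-height (con c)   _ = s≤s z≤n
  cheapest-height (vec c d C) cheapest =
    ⊥-elim (ℚP.<-irrefl refl (ℚP.<-≤-trans (<-+ˡ (cost K C) Kvec>0) (cheapest C)))
  cheapest-height (idx c is C) cheapest =
    ⊥-elim (ℚP.<-irrefl refl (ℚP.<-≤-trans (<-+ˡ (cost K C) (0<idx c)) (cheapest C)))
  cheapest-height (strc zero [] []) _ = s≤s z≤n
  cheapest-height (strc (suc c) (i ∷ is) (C ∷ Cs)) cheapest =
    ⊥-elim (ℚP.<-irrefl refl (ℚP.<-≤-trans C<strc (cheapest C)))
    where
    open ℚP.≤-Reasoning
    C<strc : cost K C ℚ.< cost K (strc (suc c) (i ∷ is) (C ∷ Cs))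
    C<strc = begin-strict
      cost K C                                   ≤⟨ ≤-+ˡ (cost K C) (0≤table 2) ⟩
      childCost (i , C)                          ≤⟨ ≤-+ʳ _ (childrenCost-nonneg (children is Cs)) ⟩
      childrenCost (children (i ∷ is) (C ∷ Cs))  <⟨ <-+ˡ _ Kstrc>0 ⟩
      Kstrc ℚ.+ childrenCost (children (i ∷ is) (C ∷ Cs)) ≡⟨ cost-strc (i ∷ is) (C ∷ Cs) ⟨
      cost K (strc (suc c) (i ∷ is) (C ∷ Cs))    ∎

  -- Below a node with count 0 the child does not affect the (empty)
  -- sequence, so optimality forces it to be a cheapest tree.
  vec₀-child-cheapest : ∀ d C → OptimalTree (vec 0 d C) → Cheapest C
  vec₀-child-cheapest d C opt C′ = hole-cheapest (vec 0 d) Kvec {C} {C′} (λ _ → refl) opt refl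

  idx₀-child-cheapest : ∀ C → OptimalTree (idx 0 [] C) → Cheapest C
  idx₀-child-cheapest C opt C′ =
    hole-cheapest (idx 0 []) (Kidx ℚ.+ ℕtoℚ 0 ℚ.* Klookup) {C} {C′} (λ _ → refl) opt refl

  -- If an optimal T consists of c copies of a cheaper C, then C represents a
  -- nonempty sequence: otherwise T represents the empty sequence too, and C
  -- would be a cheaper tree for it.
  child-nonempty : ∀ T c C → OptimalTree T → length (Flat T) ≡ c * length (Flat C) →
    cost K C ℚ.< cost K T → 1 ≤ length (Flat C)
  child-nonempty T c C opt len cheaper with Flat C in flat-C
  ... | [] = ⊥-elim (not-optimal T C opt
                       (trans flat-C (sym (length-zero (trans len (ℕP.*-zeroʳ c))))) cheaper)
  ... | _ ∷ _ = s≤s z≤n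

  childrenCost-splice : ∀ l₁ {m m′} l₂ → childrenCost m ℚ.< childrenCost m′ →
    childrenCost (l₁ ++ m ++ l₂) ℚ.< childrenCost (l₁ ++ m′ ++ l₂)
  childrenCost-splice l₁ {m} {m′} l₂ cheaper =
    subst₂ ℚ._<_ (sym (expand m)) (sym (expand m′))
      (ℚP.+-monoʳ-< (childrenCost l₁) (ℚP.+-monoˡ-< (childrenCost l₂) cheaper))
    where
    expand : ∀ m → childrenCost (l₁ ++ m ++ l₂) ≡ childrenCost l₁ ℚ.+ (childrenCost m ℚ.+ childrenCost l₂)
    expand m = trans (childrenCost-++ l₁ (m ++ l₂)) (cong (childrenCost l₁ ℚ.+_) (childrenCost-++ m l₂))

  no-cheaper-splice : ∀ {c} {is : Vec ℤ c} {Cs} l₁ x l₂ m →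
    OptimalTree (strc c is Cs) → children is Cs ≡ l₁ ++ [ x ] ++ l₂ →
    flatChildren m ≡ flatChildren [ x ] → childrenCost m ℚ.< childrenCost [ x ] → ⊥
  no-cheaper-splice {c} {is} {Cs} l₁ x l₂ m opt split same-flat cheaper =
    not-optimal (strc c is Cs) (strcOf (l₁ ++ m ++ l₂)) opt same-sequence lower-cost
    where
    same-sequence : Flat (strcOf (l₁ ++ m ++ l₂)) ≡ Flat (strc c is Cs)
    same-sequence = begin
      Flat (strcOf (l₁ ++ m ++ l₂))     ≡⟨ Flat-strcOf (l₁ ++ m ++ l₂) ⟩
      flatChildren (l₁ ++ m ++ l₂)      ≡⟨ flatChildren-splice l₁ l₂ same-flat ⟩
      flatChildren (l₁ ++ [ x ] ++ l₂)  ≡⟨ cong flatChildren split ⟨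
      flatChildren (children is Cs)     ≡⟨ flatChildren-children is Cs ⟩
      Flat (strc c is Cs)               ∎
      where open ≡-Reasoning
    lower-cost : cost K (strcOf (l₁ ++ m ++ l₂)) ℚ.< cost K (strc c is Cs)
    lower-cost = begin-strict
      cost K (strcOf (l₁ ++ m ++ l₂))           ≡⟨ cost-strcOf (l₁ ++ m ++ l₂) ⟩
      Kstrc ℚ.+ childrenCost (l₁ ++ m ++ l₂)     <⟨ ℚP.+-monoʳ-< Kstrc (childrenCost-splice l₁ l₂ cheaper) ⟩
      Kstrc ℚ.+ childrenCost (l₁ ++ [ x ] ++ l₂) ≡⟨ cong (λ l → Kstrc ℚ.+ childrenCost l) split ⟨
      Kstrc ℚ.+ childrenCost (children is Cs)    ≡⟨ cost-strc is Cs ⟨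
      cost K (strc c is Cs)                     ∎
      where open ℚP.≤-Reasoning

  strc-child-optimal : ∀ {c} {is : Vec ℤ c} {Cs i C} → OptimalTree (strc c is Cs) →
    (i , C) ∈ children is Cs → OptimalTree C
  strc-child-optimal {i = i} {C} opt mem C′ eq with ∈-∃++ mem
  ... | l₁ , l₂ , split = ℚP.≮⇒≥ λ cheaper →
    no-cheaper-splice l₁ (i , C) l₂ [ (i , C′) ] opt split (cong (λ S → shift S i ++ []) eq)
      (ℚP.+-monoˡ-< 0ℚ (ℚP.+-monoʳ-< (ℕtoℚ 2 ℚ.* Klookup) cheaper))

  -- Absorbing a strc child's offset costs nothing: the shifted strc node has
  -- the same cost, which is below that of the child it replaces.
  absorbed-strc-cheaper : ∀ i {c} (js : Vec ℤ c) Ds →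
    childrenCost (children (Vec.map (ℤ._+ i) js) Ds) ℚ.< childrenCost [ (i , strc c js Ds) ]
  absorbed-strc-cheaper i js Ds = begin-strict
    childrenCost (children (Vec.map (ℤ._+ i) js) Ds) ≡⟨ childrenCost-offsets (Vec.map (ℤ._+ i) js) js Ds ⟩
    childrenCost (children js Ds)                   <⟨ <-+ˡ _ Kstrc>0 ⟩
    Kstrc ℚ.+ childrenCost (children js Ds)         ≡⟨ cost-strc js Ds ⟨
    cost K (strc _ js Ds)                           ≤⟨ ≤-+ˡ _ (0≤table 2) ⟩
    childCost (i , strc _ js Ds)                    ≡⟨ ℚP.+-identityʳ _ ⟨
    childrenCost [ (i , strc _ js Ds) ]             ∎
    where open ℚP.≤-Reasoning

  strc-child-slack : ∀ {c} {is : Vec ℤ c} {Cs i C} → OptimalTree (strc c is Cs) →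
    (i , C) ∈ children is Cs → slack C ≡ 2
  strc-child-slack {is = is} {Cs} {i} {C} opt mem with ∈-∃++ mem
  ... | l₁ , l₂ , split = not-offset C split
    where
    not-offset : ∀ C → children is Cs ≡ l₁ ++ [ (i , C) ] ++ l₂ → slack C ≡ 2
    not-offset (con _)                 _ = refl
    not-offset (vec _ _ _)             _ = refl
    not-offset (idx zero _ _)          _ = refl
    not-offset (idx (suc (suc _)) _ _) _ = refl
    not-offset (idx (suc zero) (j ∷ []) C′) split = ⊥-elim
      (no-cheaper-splice l₁ _ l₂ [ (j ℤ.+ i , C′) ] opt split (Flat-absorb-idx₁ i j C′)
        (ℚP.+-monoˡ-< 0ℚ (ℚP.+-monoʳ-< (ℕtoℚ 2 ℚ.* Klookup) (<-+ˡ (cost K C′) (0<idx 1)))))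
    not-offset (strc _ js Ds) split = ⊥-elim
      (no-cheaper-splice l₁ _ l₂ (children (Vec.map (ℤ._+ i) js) Ds) opt split
        (trans (flatChildren-children (Vec.map (ℤ._+ i) js) Ds) (Flat-absorb-strc i js Ds))
        (absorbed-strc-cheaper i js Ds))

  idx₁-child-slack : ∀ {i} C → OptimalTree (idx 1 (i ∷ []) C) → slack C ≡ 2
  idx₁-child-slack (con _)                 _ = refl
  idx₁-child-slack (vec _ _ _)             _ = refl
  idx₁-child-slack (idx zero _ _)          _ = refl
  idx₁-child-slack (idx (suc (suc _)) _ _) _ = refl
  idx₁-child-slack {i} (idx (suc zero) (j ∷ []) C′) opt = ⊥-elim
    (not-optimal (idx 1 (i ∷ []) (idx 1 (j ∷ []) C′)) (idx 1 (j ℤ.+ i ∷ []) C′) opt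
      (Flat-absorb-idx₁ i j C′)
      (ℚP.+-monoʳ-< (Kidx ℚ.+ ℕtoℚ 1 ℚ.* Klookup) (<-+ˡ (cost K C′) (0<idx 1))))
  idx₁-child-slack {i} (strc c js Ds) opt = ⊥-elim
    (not-optimal (idx 1 (i ∷ []) (strc c js Ds)) (strc c (Vec.map (ℤ._+ i) js) Ds) opt
      (Flat-absorb-strc i js Ds)
      (<-+ˡ (cost K (strc c js Ds)) (0<idx 1)))

  copies-step : ∀ T c C → OptimalTree T → length (Flat T) ≡ suc (suc c) * length (Flat C) →
    cost K C ℚ.< cost K T → height C ≤ logBound (length (Flat C)) (slack C) →
    suc (height C) ≤ logBound (length (Flat T)) 2
  copies-step T c C opt len cheaper bound-C =
    subst (λ n → suc (height C) ≤ logBound n 2) (sym len)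
      (halving c (length (Flat C)) (child-nonempty T (suc (suc c)) C opt len cheaper) (slack≤3 C) bound-C)

  mutual
    height-bound : ∀ T → OptimalTree T → height T ≤ logBound (length (Flat T)) (slack T)
    height-bound (con c) _ = within-two (length (Flat (con c))) (s≤s z≤n)
    height-bound (vec zero d C) opt =
      within-two 0 (s≤s (cheapest-height C (vec₀-child-cheapest d C opt)))
    height-bound (vec (suc zero) d C) opt =
      ⊥-elim (not-optimal (vec 1 d C) C opt (sym (Flat-vec₁ d C)) (<-+ˡ (cost K C) Kvec>0))
    height-bound (vec (suc (suc c)) d C) opt =
      copies-step (vec (suc (suc c)) d C) c C opt (length-vec (suc (suc c)) d C) (<-+ˡ (cost K C) Kvec>0)
        (height-bound C (vec-child-optimal (suc (suc c)) d C opt))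
    height-bound (idx zero [] C) opt =
      within-two 0 (s≤s (cheapest-height C (idx₀-child-cheapest C opt)))
    height-bound (idx (suc zero) (i ∷ []) C) opt =
      subst (λ n → suc (height C) ≤ logBound n 3) (sym (length-idx₁ i C))
        (offset-step (length (Flat C))
          (at-slack-two (length (Flat C)) C (idx₁-child-slack C opt)
            (height-bound C (idx-child-optimal 1 (i ∷ []) C opt))))
    height-bound (idx (suc (suc c)) is C) opt =
      copies-step (idx (suc (suc c)) is C) c C opt (length-idx is C) (<-+ˡ (cost K C) (0<idx (suc (suc c))))
        (height-bound C (idx-child-optimal (suc (suc c)) is C opt))
    height-bound (strc c is Cs) opt =
      offset-step (length (Flat (strc c is Cs))) (children-height-bound is Cs λ mem →
        strc-child-optimal opt mem , strc-child-slack opt mem , strc-child-length mem)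

    children-height-bound : ∀ {c} (is : Vec ℤ c) Cs {n} →
      (∀ {i C} → (i , C) ∈ children is Cs → OptimalTree C × slack C ≡ 2 × length (Flat C) ≤ n) →
      heights Cs ≤ logBound n 2
    children-height-bound []       []       _ = z≤n
    children-height-bound (i ∷ is) (C ∷ Cs) facts with facts (here refl)
    ... | opt , slack≡2 , short = ℕP.⊔-lub
      (ℕP.≤-trans (at-slack-two (length (Flat C)) C slack≡2 (height-bound C opt)) (logBound-monoˡ 2 short))
      (children-height-bound is Cs (facts ∘ there))

proposition1 : (K : CostConstants) →
    Σ ℕ (λ A → Σ ℕ (λ B →
      ∀ (D : DispSeq) (T : Tree) → Optimal K T D →
        height T ≤ A * ⌊log₂ length D ⌋ + B))
proposition1 K = 2 , 3 , bound
  where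
  open Optimality K
  bound : ∀ D T → Optimal K T D → height T ≤ logBound (length D) 3
  bound D T optimal = subst (λ S → height T ≤ logBound (length S) 3) (proj₁ optimal)
    (ℕP.≤-trans (height-bound T (optimal⇒OptimalTree {T} {D} optimal))
                (logBound-monoʳ (length (Flat T)) (slack≤3 T)))
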